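{- For every $n\ge0$ there exists a bijection between relaxed binary trees of size $n$ and the set $\mathcal{D}_n$ of horizontally decorated Dyck paths of length $2n$.
   Context: A relaxed binary tree of size $n$ is a directed acyclic graph obtained from a (rooted, plane) binary tree with $n$ internal nodes (its spine; every node has 0 or 2 ordered children) by keeping the left-most leaf and turning every other leaf into a pointer, each pointing to a node (an internal node or the left-most leaf) that precedes that leaf in the postorder of the spine. A horizontally decorated path is a lattice path starting at $(0,0)$ with steps $H=(1,0)$ and $V=(0,1)$ confined to the region $0\le y\le x$, where each $H$ step is decorated by a number in $\{1,\dots,k+1\}$, $k$ being the $y$-coordinate of that step. It is a horizontally decorated Dyck path (of length $2n$) if it ends at $(n,n)$; $\mathcal{D}_n$ denotes the set of these. -}

module Defs where

open import Data.Nat using (ℕ; zero; suc; _+_; _<_)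
open import Data.Fin using (Fin)
open import Data.Maybe using (Maybe; just; nothing)
open import Data.Bool using (Bool; true; false)
open import Data.List using (List; []; _∷_; _++_; [_]; _∷ʳ_)
open import Data.Product using (Σ; _×_)
open import Relation.Binary.PropositionalEquality using (_≡_)

-- A binary tree (the spine) whose leaves are labelled:
--   lf nothing   : a kept leaf (this must be exactly the left-most leaf),
--   lf (just j)  : a pointer leaf, pointing to the node that sits at
--                  position j (0-based) in the postorder of the spine.
data PTree : Set where
  lf : Maybe ℕ → PTree
  nd : PTree → PTree → PTree

size : PTree → ℕ
size (lf _)   = 0
size (nd l r) = suc (size l + size r)

data Entry : Set where
  inner : Entry
  kept  : Entry
  ptr   : ℕ → Entry

postorder : PTree → List Entry
postorder (lf nothing)  = [ kept ]
postorder (lf (just j)) = [ ptr j ]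
postorder (nd l r)      = postorder l ++ postorder r ++ [ inner ]

data LeavesOK : Bool → PTree → Set where
  keptLeaf : LeavesOK true (lf nothing)
  ptrLeaf  : ∀ j → LeavesOK false (lf (just j))
  node     : ∀ {b l r} → LeavesOK b l → LeavesOK false r → LeavesOK b (nd l r)

data PointableAt : List Entry → ℕ → Set where
  here-inner : ∀ {es} → PointableAt (inner ∷ es) zero
  here-kept  : ∀ {es} → PointableAt (kept ∷ es) zero
  there      : ∀ {e es j} → PointableAt es j → PointableAt (e ∷ es) (suc j)

data PointersOK : List Entry → List Entry → Set where
  done   : ∀ {pre} → PointersOK pre []
  inner∷ : ∀ {pre rest} → PointersOK (pre ∷ʳ inner) rest → PointersOK pre (inner ∷ rest)
  kept∷  : ∀ {pre rest} → PointersOK (pre ∷ʳ kept) rest → PointersOK pre (kept ∷ rest)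
  ptr∷   : ∀ {pre rest j} → PointableAt pre j → PointersOK (pre ∷ʳ ptr j) rest →
           PointersOK pre (ptr j ∷ rest)

RelaxedTree : ℕ → Set
RelaxedTree n = Σ PTree (λ t → LeavesOK true t × PointersOK [] (postorder t) × size t ≡ n)

-- DecPath x y : horizontally decorated paths from (0,0) to (x,y), built step
-- by step, staying in 0 ≤ y ≤ x.  An H step taken at height y carries a
-- decoration i : Fin (suc y), standing for the number toℕ i + 1 ∈ {1,…,y+1}.
data DecPath : ℕ → ℕ → Set where
  start : DecPath 0 0
  stepH : ∀ {x y} → DecPath x y → Fin (suc y) → DecPath (suc x) y
  stepV : ∀ {x y} → DecPath x y → y < x → DecPath x (suc y)

𝒟 : ℕ → Set
𝒟 n = DecPath n n

module Submission where

-- Both objects are read as words over Entry.  A relaxed tree is read by its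
-- postorder; a path is read step by step, its start being the kept leaf, an
-- H step a pointer leaf and a V step an internal node.  An H step at height
-- y carries a decoration in {1,…,y+1}: the prefix read so far contains
-- exactly y+1 pointable entries (y internal nodes and the kept leaf), and the
-- decoration selects the one the new pointer leaf points to.
--
-- The key notion is the stack of a path: the forest of subtrees completed so
-- far, where an H step pushes a leaf and a V step joins the two topmost trees.
-- Its invariants (shape, total size y, height x + 1 − y, flattening = word)
-- show at once that V steps are allowed exactly when two trees are stacked,
-- and that a Dyck path ends with a single tree.

open import Defs
open import Data.Nat using (ℕ; zero; suc; _+_; _<_; s≤s; z≤n)
open import Data.Nat.Properties
  using (≡-irrelevant; <-irrelevant; <-irrefl; <-trans; n<1+n; m≤n+m; suc-injective; +-suc; +-assoc; +-comm; +-identityʳ)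
open import Data.Fin using (Fin; toℕ; fromℕ<)
open import Data.Fin.Properties using (toℕ-fromℕ<; toℕ-injective; toℕ<n)
open import Data.Maybe using (just; nothing)
open import Data.Bool using (Bool; true; false)
open import Data.List using (List; []; _∷_; _++_; [_]; _∷ʳ_; length)
open import Data.List.Properties using (++-assoc; ++-identityʳ; ∷ʳ-injective; ∷-injectiveˡ)
open import Data.Product using (Σ; _×_; _,_; proj₁; proj₂)
open import Data.Unit using (⊤; tt)
open import Data.Empty using (⊥-elim)
open import Relation.Binary.PropositionalEquality
  using (_≡_; refl; sym; trans; cong; cong₂; subst; subst₂; module ≡-Reasoning)
open import Function.Bundles using (_⤖_; mk↔ₛ′)
open import Function.Properties.Inverse using (↔⇒⤖)

private
  variable
    x y x′ y′ n j : ℕ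
    b : Bool
    pre w es : List Entry
    e : Entry
    s : List PTree
    t l r : PTree

LeavesOK-irrelevant : (p q : LeavesOK b t) → p ≡ q
LeavesOK-irrelevant keptLeaf    keptLeaf    = refl
LeavesOK-irrelevant (ptrLeaf j) (ptrLeaf j) = refl
LeavesOK-irrelevant (node p p′) (node q q′) =
  cong₂ node (LeavesOK-irrelevant p q) (LeavesOK-irrelevant p′ q′)

PointableAt-irrelevant : (p q : PointableAt es j) → p ≡ q
PointableAt-irrelevant here-inner here-inner = refl
PointableAt-irrelevant here-kept  here-kept  = refl
PointableAt-irrelevant (there p)  (there q)  = cong there (PointableAt-irrelevant p q)

PointersOK-irrelevant : (p q : PointersOK pre es) → p ≡ q
PointersOK-irrelevant done       done       = refl
PointersOK-irrelevant (inner∷ p) (inner∷ q) = cong inner∷ (PointersOK-irrelevant p q)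
PointersOK-irrelevant (kept∷ p)  (kept∷ q)  = cong kept∷ (PointersOK-irrelevant p q)
PointersOK-irrelevant (ptr∷ a p) (ptr∷ c q) =
  cong₂ ptr∷ (PointableAt-irrelevant a c) (PointersOK-irrelevant p q)

spine : RelaxedTree n → PTree
spine = proj₁

relaxedTree-≡ : (u v : RelaxedTree n) → spine u ≡ spine v → u ≡ v
relaxedTree-≡ (t , lo , po , sz) (.t , lo′ , po′ , sz′) refl
  rewrite LeavesOK-irrelevant lo lo′ | PointersOK-irrelevant po po′ | ≡-irrelevant sz sz′ = refl

EntryOK : List Entry → Entry → Set
EntryOK pre inner   = ⊤
EntryOK pre kept    = ⊤
EntryOK pre (ptr j) = PointableAt pre j

pointers-∷⁻ : PointersOK pre (e ∷ es) → EntryOK pre e × PointersOK (pre ∷ʳ e) es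
pointers-∷⁻ (inner∷ p)  = tt , p
pointers-∷⁻ (kept∷ p)   = tt , p
pointers-∷⁻ (ptr∷ pa p) = pa , p

pointers-∷⁺ : EntryOK pre e → PointersOK (pre ∷ʳ e) es → PointersOK pre (e ∷ es)
pointers-∷⁺ {e = inner} _  p = inner∷ p
pointers-∷⁺ {e = kept}  _  p = kept∷ p
pointers-∷⁺ {e = ptr j} pa p = ptr∷ pa p

pointers-++⁻ : ∀ xs {ys} → PointersOK pre (xs ++ ys) → PointersOK pre xs × PointersOK (pre ++ xs) ys
pointers-++⁻ {pre} [] p = done , subst (λ v → PointersOK v _) (sym (++-identityʳ pre)) p
pointers-++⁻ {pre} (e ∷ xs) p =
  let ok , p′  = pointers-∷⁻ p
      ps , qs = pointers-++⁻ xs p′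
  in pointers-∷⁺ ok ps , subst (λ v → PointersOK v _) (++-assoc pre [ e ] xs) qs

pointers-++⁺ : ∀ xs {ys} → PointersOK pre xs → PointersOK (pre ++ xs) ys → PointersOK pre (xs ++ ys)
pointers-++⁺ {pre} [] _ q = subst (λ v → PointersOK v _) (++-identityʳ pre) q
pointers-++⁺ {pre} (e ∷ xs) p q =
  let ok , p′ = pointers-∷⁻ p
  in pointers-∷⁺ ok (pointers-++⁺ xs p′ (subst (λ v → PointersOK v _) (sym (++-assoc pre [ e ] xs)) q))

node-pointers : ∀ l r → PointersOK pre (postorder (nd l r)) →
                PointersOK pre (postorder l) × PointersOK (pre ++ postorder l) (postorder r)
node-pointers l r po =
  let pl , rest = pointers-++⁻ (postorder l) po
  in pl , proj₁ (pointers-++⁻ (postorder r) rest)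

node-word : ∀ w l r → ((w ++ postorder l) ++ postorder r) ∷ʳ inner ≡ w ++ postorder (nd l r)
node-word w l r = begin
  ((w ++ postorder l) ++ postorder r) ++ [ inner ]  ≡⟨ ++-assoc (w ++ postorder l) (postorder r) [ inner ] ⟩
  (w ++ postorder l) ++ (postorder r ++ [ inner ])  ≡⟨ ++-assoc w (postorder l) _ ⟩
  w ++ postorder (nd l r)                           ∎
  where open ≡-Reasoning

pointables : List Entry → ℕ
pointables []           = 0
pointables (inner ∷ es) = suc (pointables es)
pointables (kept ∷ es)  = suc (pointables es)
pointables (ptr _ ∷ es) = pointables es

pointables-++ : ∀ xs ys → pointables (xs ++ ys) ≡ pointables xs + pointables ys
pointables-++ []           ys = refl
pointables-++ (inner ∷ xs) ys = cong suc (pointables-++ xs ys)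
pointables-++ (kept ∷ xs)  ys = cong suc (pointables-++ xs ys)
pointables-++ (ptr _ ∷ xs) ys = pointables-++ xs ys

select : List Entry → ℕ → ℕ
select []           _       = 0
select (inner ∷ es) zero    = 0
select (inner ∷ es) (suc k) = suc (select es k)
select (kept ∷ es)  zero    = 0
select (kept ∷ es)  (suc k) = suc (select es k)
select (ptr _ ∷ es) k       = suc (select es k)

select-pointable : ∀ es {k} → k < pointables es → PointableAt es (select es k)
select-pointable (inner ∷ es) {zero}  _       = here-inner
select-pointable (inner ∷ es) {suc k} (s≤s h) = there (select-pointable es h)
select-pointable (kept ∷ es)  {zero}  _       = here-kept
select-pointable (kept ∷ es)  {suc k} (s≤s h) = there (select-pointable es h)
select-pointable (ptr _ ∷ es) h               = there (select-pointable es h)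

rank : PointableAt es j → ℕ
rank here-inner              = 0
rank here-kept               = 0
rank (there {e = inner} p)   = suc (rank p)
rank (there {e = kept} p)    = suc (rank p)
rank (there {e = ptr _} p)   = rank p

rank-bound : (p : PointableAt es j) → rank p < pointables es
rank-bound here-inner            = s≤s z≤n
rank-bound here-kept             = s≤s z≤n
rank-bound (there {e = inner} p) = s≤s (rank-bound p)
rank-bound (there {e = kept} p)  = s≤s (rank-bound p)
rank-bound (there {e = ptr _} p) = rank-bound p

select-rank : (p : PointableAt es j) → select es (rank p) ≡ j
select-rank here-inner            = refl
select-rank here-kept             = refl
select-rank (there {e = inner} p) = cong suc (select-rank p)
select-rank (there {e = kept} p)  = cong suc (select-rank p)
select-rank (there {e = ptr _} p) = cong suc (select-rank p)

rank-select : ∀ es {k} (h : k < pointables es) → rank (select-pointable es h) ≡ k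
rank-select (inner ∷ es) {zero}  _       = refl
rank-select (inner ∷ es) {suc k} (s≤s h) = cong suc (rank-select es h)
rank-select (kept ∷ es)  {zero}  _       = refl
rank-select (kept ∷ es)  {suc k} (s≤s h) = cong suc (rank-select es h)
rank-select (ptr _ ∷ es) h               = rank-select es h

select-injective : ∀ es {k k′} → k < pointables es → k′ < pointables es →
                   select es k ≡ select es k′ → k ≡ k′
select-injective es {k} {k′} h h′ eq = begin
  k                                 ≡⟨ sym (rank-select es h) ⟩
  rank (select-pointable es h)      ≡⟨ same-rank (select-pointable es h) (select-pointable es h′) eq ⟩
  rank (select-pointable es h′)     ≡⟨ rank-select es h′ ⟩
  k′                                ∎
  where
  open ≡-Reasoning
  same-rank : ∀ {i i′} (p : PointableAt es i) (q : PointableAt es i′) → i ≡ i′ → rank p ≡ rank q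
  same-rank p q refl = cong rank (PointableAt-irrelevant p q)

word : DecPath x y → List Entry
word start       = [ kept ]
word (stepH p i) = word p ∷ʳ ptr (select (word p) (toℕ i))
word (stepV p _) = word p ∷ʳ inner

target : DecPath x y → Fin (suc y) → ℕ
target p i = select (word p) (toℕ i)

pointables-word : (p : DecPath x y) → pointables (word p) ≡ suc y
pointables-word start = refl
pointables-word (stepH p i) =
  trans (pointables-++ (word p) _) (trans (+-identityʳ _) (pointables-word p))
pointables-word (stepV p _) =
  trans (pointables-++ (word p) _) (trans (+-comm _ 1) (cong suc (pointables-word p)))

decoration-bound : (p : DecPath x y) (i : Fin (suc y)) → toℕ i < pointables (word p)
decoration-bound p i = subst (toℕ i <_) (sym (pointables-word p)) (toℕ<n i)

decoration-injective : (p : DecPath x y) (i i′ : Fin (suc y)) → target p i ≡ target p i′ → i ≡ i′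
decoration-injective p i i′ eq =
  toℕ-injective (select-injective (word p) (decoration-bound p i) (decoration-bound p i′) eq)

decoration-for : (p : DecPath x y) → PointableAt (word p) j → Σ (Fin (suc y)) λ i → target p i ≡ j
decoration-for p pa =
  fromℕ< (subst (rank pa <_) (pointables-word p) (rank-bound pa)) ,
  trans (cong (select (word p)) (toℕ-fromℕ< _)) (select-rank pa)

word-pointers : (p : DecPath x y) → PointersOK [] (word p)
word-pointers start       = kept∷ done
word-pointers (stepH p i) =
  pointers-++⁺ (word p) (word-pointers p) (ptr∷ (select-pointable _ (decoration-bound p i)) done)
word-pointers (stepV p _) = pointers-++⁺ (word p) (word-pointers p) (inner∷ done)

word-injective : (p q : DecPath x y) → word p ≡ word q → p ≡ q
word-injective start start _ = refl
word-injective (stepH p i) (stepH q i′) eq with ∷ʳ-injective (word p) (word q) eq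
... | words , targets with word-injective p q words
...   | refl = cong (stepH p) (decoration-injective p i i′ (ptr-injective targets))
  where
  ptr-injective : ∀ {k k′} → ptr k ≡ ptr k′ → k ≡ k′
  ptr-injective refl = refl
word-injective (stepH p _) (stepV q _) eq with ∷ʳ-injective (word p) (word q) eq
... | _ , ()
word-injective (stepV p _) (stepH q _) eq with ∷ʳ-injective (word p) (word q) eq
... | _ , ()
word-injective (stepV p lt) (stepV q lt′) eq with word-injective p q (proj₁ (∷ʳ-injective (word p) (word q) eq))
... | refl = cong (stepV p) (<-irrelevant lt lt′)

combine : List PTree → List PTree
combine (r ∷ l ∷ s) = nd l r ∷ s
combine s           = s

stack : DecPath x y → List PTree
stack start       = [ lf nothing ]
stack (stepH p i) = lf (just (target p i)) ∷ stack p
stack (stepV p _) = combine (stack p)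

flatten : List PTree → List Entry
flatten []      = []
flatten (t ∷ s) = flatten s ++ postorder t

totalSize : List PTree → ℕ
totalSize []      = 0
totalSize (t ∷ s) = totalSize s + size t

data Shaped : List PTree → Set where
  bottom  : LeavesOK true t → Shaped [ t ]
  _above_ : LeavesOK false t → Shaped s → Shaped (t ∷ s)

bottom-leaves : Shaped [ t ] → LeavesOK true t
bottom-leaves (bottom lo)   = lo
bottom-leaves (_ above ())

record StackInv (x y : ℕ) (w : List Entry) (s : List PTree) : Set where
  field
    shaped : Shaped s
    flat   : flatten s ≡ w
    total  : totalSize s ≡ y
    height : length s + y ≡ suc x
open StackInv

-- By the height invariant, a stack of at least two trees lies strictly below
-- the diagonal, so a V step may join them.
V-allowed : ∀ k → suc (suc k) + y ≡ suc x → y < x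
V-allowed {y = y} k h = subst (y <_) (suc-injective h) (s≤s (m≤n+m y k))

stackInv-push : StackInv x y w s → StackInv (suc x) y (w ∷ʳ ptr j) (lf (just j) ∷ s)
stackInv-push {j = j} inv = record
  { shaped = ptrLeaf j above shaped inv
  ; flat   = cong (_∷ʳ ptr j) (flat inv)
  ; total  = trans (+-identityʳ _) (total inv)
  ; height = cong suc (height inv)
  }

stackInv-combine : y < x → StackInv x y w s → StackInv x (suc y) (w ∷ʳ inner) (combine s)
stackInv-combine {x = x} {s = []} lt inv =
  ⊥-elim (<-irrefl refl (<-trans (n<1+n x) (subst (_< x) (height inv) lt)))
stackInv-combine {s = _ ∷ []} lt inv = ⊥-elim (<-irrefl (suc-injective (height inv)) lt)
stackInv-combine {s = r ∷ l ∷ s} _ inv = record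
  { shaped = joined (shaped inv)
  ; flat   = trans (sym (node-word (flatten s) l r)) (cong (_∷ʳ inner) (flat inv))
  ; total  = trans (+-suc (totalSize s) _)
                   (cong suc (trans (sym (+-assoc (totalSize s) (size l) (size r))) (total inv)))
  ; height = trans (cong suc (+-suc (length s) _)) (height inv)
  }
  where
  joined : Shaped (r ∷ l ∷ s) → Shaped (nd l r ∷ s)
  joined (ro above bottom lo)     = bottom (node lo ro)
  joined (ro above (lo above sh)) = node lo ro above sh

stack-invariant : (p : DecPath x y) → StackInv x y (word p) (stack p)
stack-invariant start        = record { shaped = bottom keptLeaf ; flat = refl ; total = refl ; height = refl }
stack-invariant (stepH p i)  = stackInv-push (stack-invariant p)
stack-invariant (stepV p lt) = stackInv-combine lt (stack-invariant p)

lone-tree : StackInv n n w s → Σ PTree λ t → s ≡ [ t ]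
lone-tree {n = n} {s = []} inv = ⊥-elim (<-irrefl (height inv) (n<1+n n))
lone-tree {s = t ∷ []}     _   = t , refl
lone-tree {s = _ ∷ _ ∷ s}  inv = ⊥-elim (<-irrefl refl (V-allowed (length s) (height inv)))

record Extension (s : List PTree) (w : List Entry) (t : PTree) : Set where
  field
    {endX endY} : ℕ
    path   : DecPath endX endY
    word≡  : word path ≡ w ++ postorder t
    stack≡ : stack path ≡ t ∷ s
open Extension

-- A pointer leaf is one H step, decorated by the rank of its target.
extend-leaf : (acc : DecPath x y) → PointableAt (word acc) j →
              Extension (stack acc) (word acc) (lf (just j))
extend-leaf acc pa =
  let i , i↦j = decoration-for acc pa in record
  { path   = stepH acc i
  ; word≡  = cong (λ k → word acc ∷ʳ ptr k) i↦j
  ; stack≡ = cong (λ k → lf (just k) ∷ stack acc) i↦j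
  }

graft : (e : Extension s w l) → Extension (stack (path e)) (word (path e)) r → Extension s w (nd l r)
graft {s = s} {w = w} {l = l} {r = r} e e′ = record
  { path   = stepV (path e′) (V-allowed (length s) two-trees)
  ; word≡  = trans (cong (_∷ʳ inner) (trans (word≡ e′) (cong (_++ postorder r) (word≡ e)))) (node-word w l r)
  ; stack≡ = cong combine stacked
  }
  where
  stacked : stack (path e′) ≡ r ∷ l ∷ s
  stacked = trans (stack≡ e′) (cong (r ∷_) (stack≡ e))

  two-trees : length (r ∷ l ∷ s) + endY e′ ≡ suc (endX e′)
  two-trees = subst (λ z → length z + endY e′ ≡ suc (endX e′)) stacked (height (stack-invariant (path e′)))

right-pointers : (e : Extension s w l) (r : PTree) → PointersOK (w ++ postorder l) (postorder r) →
                 PointersOK (word (path e)) (postorder r)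
right-pointers e r = subst (λ v → PointersOK v _) (sym (word≡ e))

extend : (acc : DecPath x y) → LeavesOK false t → PointersOK (word acc) (postorder t) →
         Extension (stack acc) (word acc) t
extend acc (ptrLeaf j) (ptr∷ pa done) = extend-leaf acc pa
extend acc (node {l = l} {r = r} lo ro) po =
  let pl , pr = node-pointers l r po
      e       = extend acc lo pl
  in graft e (extend (path e) ro (right-pointers e r pr))

build : LeavesOK true t → PointersOK [] (postorder t) → Extension [] [] t
build keptLeaf _ = record { path = start ; word≡ = refl ; stack≡ = refl }
build (node {l = l} {r = r} lo ro) po =
  let pl , pr = node-pointers l r po
      e       = build lo pl
  in graft e (extend (path e) ro (right-pointers e r pr))

reindex : (ex : x ≡ x′) (ey : y ≡ y′) (p : DecPath x y) →
          word (subst₂ DecPath ex ey p) ≡ word p × stack (subst₂ DecPath ex ey p) ≡ stack p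
reindex refl refl p = refl , refl

encode : (u : RelaxedTree n) → Σ (𝒟 n) λ p → word p ≡ postorder (spine u) × stack p ≡ [ spine u ]
encode (t , lo , po , sz) =
  let e       = build lo po
      inv     = subst (StackInv _ _ _) (stack≡ e) (stack-invariant (path e))
      y≡n     = trans (sym (total inv)) sz
      x≡n     = trans (sym (suc-injective (height inv))) y≡n
      w≡ , s≡ = reindex x≡n y≡n (path e)
  in subst₂ DecPath x≡n y≡n (path e) , trans w≡ (word≡ e) , trans s≡ (stack≡ e)

-- The spine of a Dyck path is its final lone tree; the invariant supplies
-- its leaves, its pointer validity (via the word) and its size.
decode : (p : 𝒟 n) → Σ (RelaxedTree n) λ u → stack p ≡ [ spine u ]
decode p =
  let inv     = stack-invariant p
      t , s≡  = lone-tree inv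
      inv′    = subst (StackInv _ _ _) s≡ inv
  in (t , bottom-leaves (shaped inv′)
        , subst (PointersOK []) (sym (flat inv′)) (word-pointers p)
        , total inv′)
     , s≡

decode-postorder : (p : 𝒟 n) → postorder (spine (proj₁ (decode p))) ≡ word p
decode-postorder p = flat (subst (StackInv _ _ _) (proj₂ (decode p)) (stack-invariant p))

theorem2p5 : (n : ℕ) → RelaxedTree n ⤖ 𝒟 n
theorem2p5 n = ↔⇒⤖ (mk↔ₛ′ to from to∘from from∘to)
  where
  to : RelaxedTree n → 𝒟 n
  to u = proj₁ (encode u)

  from : 𝒟 n → RelaxedTree n
  from p = proj₁ (decode p)

  -- paths are determined by their words
  to∘from : ∀ p → to (from p) ≡ p
  to∘from p = let word≡postorder , _ = proj₂ (encode (from p)) in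
    word-injective _ p (trans word≡postorder (decode-postorder p))

  -- relaxed trees are determined by their spines, read off the final stack
  from∘to : ∀ u → from (to u) ≡ u
  from∘to u = let _ , stack≡spine = proj₂ (encode u) in
    relaxedTree-≡ _ u (∷-injectiveˡ (trans (sym (proj₂ (decode (to u)))) stack≡spine))
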